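{- Let $\mathcal{C}$ be a sum closed permutation class. For every $n\ge1$, \[|\oplus\mathcal{C}_n|=n\sum_{\pi\in\mathcal{C}_n}\frac{1}{\chi(\pi)},\] where $\chi(\pi)$ is the number of sum-indecomposable blocks of $\pi$.
   Context: A permutation class is a set of finite permutations closed under containment; $\mathcal{C}_n=\mathcal{C}\cap S_n$. The sum $\sigma\oplus\tau$ of $\sigma\in S_a$ and $\tau\in S_b$ equals $\sigma(i)$ for $i\le a$ and $a+\tau(i-a)$ for $i>a$. A class is sum closed if it is closed under $\oplus$. Each permutation is uniquely a sum of indecomposable permutations (permutations that are not sums of two permutations of nonzero size), called its blocks. For $\pi\in S_n$, $\oplus\pi(i+kn)=\pi(i)+kn$ for $i\in[n]$ and $k\in\mathbb{Z}$. The shift is $\Sigma^r\sigma(i)=\sigma(i-r)+r$. We set $\oplus\mathcal{C}_n=\{\Sigma^r(\oplus\pi):\pi\in\mathcal{C}_n,\ r\in\mathbb{Z}\}$, a set of bijections of $\mathbb{Z}$. -}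

module Defs where

open import Data.Nat as ℕ using (ℕ; zero; suc; _≤_)
open import Data.Fin as Fin using (Fin; _↑ˡ_; _↑ʳ_; splitAt; toℕ; fromℕ<)
open import Data.Fin.Properties using (toℕ<n)
open import Data.Vec using (Vec; []; lookup; tabulate)
open import Data.Integer as ℤ using (ℤ; +_)
open import Data.Integer.DivMod using (_/ℕ_; _%ℕ_; n%ℕd<d)
open import Data.Rational as ℚ using (ℚ; 0ℚ)
open import Data.List using (List; foldr)
open import Data.Product using (Σ; ∃; _×_; _,_)
open import Data.Sum using ([_,_])
open import Function.Bundles using (_⇔_)
open import Relation.Nullary using (¬_)
open import Relation.Binary.PropositionalEquality using (_≡_; subst)

-- A permutation of size n in one-line notation: the i-th entry (0-indexed)
-- is the (0-indexed) value π(i+1)-1.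
Perm : ℕ → Set
Perm n = Vec (Fin n) n

IsPerm : ∀ {n} → Perm n → Set
IsPerm {n} π = ∀ (i j : Fin n) → lookup π i ≡ lookup π j → i ≡ j

Contains : ∀ {n k} → Perm n → Perm k → Set
Contains {n} {k} π σ =
  Σ (Fin k → Fin n) λ f →
    (∀ i j → i Fin.< j → f i Fin.< f j) ×
    (∀ i j → (lookup σ i Fin.< lookup σ j) ⇔ (lookup π (f i) Fin.< lookup π (f j)))

_⊕_ : ∀ {a b} → Perm a → Perm b → Perm (a ℕ.+ b)
_⊕_ {a} {b} σ τ =
  tabulate (λ i → [ (λ x → lookup σ x ↑ˡ b) , (λ y → a ↑ʳ lookup τ y) ] (splitAt a i))

record PermClass : Set₁ where
  field
    C      : (n : ℕ) → Perm n → Set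
    isPerm : ∀ {n} {π : Perm n} → C n π → IsPerm π
    closed : ∀ {n k} {π : Perm n} {σ : Perm k} →
             IsPerm σ → Contains π σ → C n π → C k σ
open PermClass public

SumClosed : PermClass → Set
SumClosed 𝒞 = ∀ {a b} {σ : Perm a} {τ : Perm b} → C 𝒞 a σ → C 𝒞 b τ → C 𝒞 (a ℕ.+ b) (σ ⊕ τ)

Indecomposable : ∀ {a} → Perm a → Set
Indecomposable {a} π =
  IsPerm π × 1 ≤ a ×
  (∀ b c (σ : Perm b) (τ : Perm c) (e : b ℕ.+ c ≡ a) → 1 ≤ b → 1 ≤ c →
     IsPerm σ → IsPerm τ → ¬ (subst Perm e (σ ⊕ τ) ≡ π))

data HasBlocks : (n : ℕ) → Perm n → ℕ → Set where
  nil  : HasBlocks 0 [] 0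
  cons : ∀ {a b k} (σ : Perm a) (τ : Perm b) → Indecomposable σ →
         HasBlocks b τ k → HasBlocks (a ℕ.+ b) (σ ⊕ τ) (suc k)

-- ⊕π : ℤ → ℤ, ⊕π(i + kn) = π(i) + kn for i ∈ [n] (1-indexed), k ∈ ℤ.
-- Writing m - 1 = q n + r with 0 ≤ r < n, i = r + 1, we get ⊕π(m) = π(r+1) + q n.
oplusZ : ∀ {n} → Perm n → ℤ → ℤ
oplusZ {zero}  π m = m
oplusZ {suc k} π m =
  + suc (toℕ (lookup π (fromℕ< (n%ℕd<d (m ℤ.- + 1) (suc k)))))
    ℤ.+ ((m ℤ.- + 1) /ℕ suc k) ℤ.* + suc k

shift : ℤ → (ℤ → ℤ) → (ℤ → ℤ)
shift r σ i = σ (i ℤ.- r) ℤ.+ r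

-- ImageCard P f _≈_ N : the set { f a | P a } (elements compared by _≈_)
-- has exactly N elements: an enumeration by Fin N that is injective up to ≈
-- and hits every element up to ≈.
ImageCard : {A B : Set} → (A → Set) → (A → B) → (B → B → Set) → ℕ → Set
ImageCard {A} P f _≈_ N =
  Σ (Fin N → A) λ e →
    (∀ k → P (e k)) ×
    (∀ k l → f (e k) ≈ f (e l) → k ≡ l) ×
    (∀ a → P a → ∃ λ k → f (e k) ≈ f a)

-- 1/k as a rational (the value at 0 is an irrelevant convention; χ(π) ≥ 1 for n ≥ 1).
recip : ℕ → ℚ
recip zero    = 0ℚ
recip (suc k) = + 1 ℚ./ suc k

sumℚ : List ℚ → ℚ
sumℚ = foldr ℚ._+_ 0ℚ

module Submission where

-- Since Σ^{r+n}(⊕π) = Σ^r(⊕π), the set ⊕𝒞ₙ is the image of X = 𝒞ₙ × [0,n) under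
-- (π , r) ↦ Σ^r(⊕π).  Call c a cut of π when π maps [0,c) onto itself;
-- then π = α ⊕ β with |α| = c, and the rotation of π at c is β ⊕ α.  The key
-- fact is: Σ^r(⊕π) = Σ^s(⊕σ) iff d = (s - r) mod n is a cut of π and σ is the
-- rotation of π at d.  Rotations stay in 𝒞 because 𝒞 is sum closed, so the
-- class of (π , r) in X has exactly as many elements as π has cuts in [0,n),
-- and these cuts are the starting points of its χ(π) blocks.  Finally, for any
-- decidable equivalence on a finite list, Σ_x 1/|class of x| is the number of
-- classes, and a list of class representatives provides the enumeration that
-- ImageCard asks for.

open import Defs
open import Data.Nat using (ℕ; suc)
open import Data.List using (List)
open import Data.List.Membership.Propositional using (_∈_)
open import Data.List.Relation.Unary.Unique.Propositional using (Unique)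
open import Function.Bundles using (_⇔_)
open import Relation.Nullary using (Dec)

module NatRat where

  open import Data.Nat as ℕ using (ℕ; suc)
  import Data.Nat.Properties as ℕP
  open import Data.Integer as ℤ using (+_)
  import Data.Integer.Properties as ℤP
  open import Data.Rational as ℚ using (ℚ; _/_; 1ℚ; _+_; _*_)
  open import Data.Rational.Properties using (toℚᵘ-injective; toℚᵘ-fromℚᵘ; toℚᵘ-homo-+; toℚᵘ-homo-*)
  import Data.Rational.Unnormalised as ℚᵘ
  import Data.Rational.Unnormalised.Properties as ℚᵘP
  open import Relation.Binary.PropositionalEquality

  fromℕ : ℕ → ℚ
  fromℕ a = + a / 1

  -- Both facts are checked in the unnormalised rationals, where a/1 is a literal fraction.
  fromℕ-+ : ∀ a b → fromℕ (a ℕ.+ b) ≡ fromℕ a + fromℕ b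
  fromℕ-+ a b = toℚᵘ-injective (ℚᵘP.≃-trans (toℚᵘ-fromℚᵘ (ℚᵘ.mkℚᵘ (+ (a ℕ.+ b)) 0))
    (ℚᵘP.≃-trans (ℚᵘ.*≡* cross)
     (ℚᵘP.≃-sym (ℚᵘP.≃-trans (toℚᵘ-homo-+ (fromℕ a) (fromℕ b))
       (ℚᵘP.+-cong (toℚᵘ-fromℚᵘ (ℚᵘ.mkℚᵘ (+ a) 0)) (toℚᵘ-fromℚᵘ (ℚᵘ.mkℚᵘ (+ b) 0)))))))
    where
    cross : + (a ℕ.+ b) ℤ.* + 1 ≡ (+ a ℤ.* + 1 ℤ.+ + b ℤ.* + 1) ℤ.* + 1
    cross = trans (ℤP.*-identityʳ _) (trans (ℤP.pos-+ a b) (sym (trans (ℤP.*-identityʳ _)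
              (cong₂ ℤ._+_ (ℤP.*-identityʳ (+ a)) (ℤP.*-identityʳ (+ b))))))

  fromℕ-*-recip : ∀ m → fromℕ (suc m) * recip (suc m) ≡ 1ℚ
  fromℕ-*-recip m = toℚᵘ-injective (ℚᵘP.≃-trans (toℚᵘ-homo-* (fromℕ (suc m)) (recip (suc m)))
    (ℚᵘP.≃-trans (ℚᵘP.*-cong (toℚᵘ-fromℚᵘ (ℚᵘ.mkℚᵘ (+ suc m) 0)) (toℚᵘ-fromℚᵘ (ℚᵘ.mkℚᵘ (+ 1) m)))
     (ℚᵘ.*≡* (cong (λ z → + suc z) cross))))
    where
    cross : m ℕ.* 1 ℕ.* 1 ≡ m ℕ.+ 0 ℕ.* suc m ℕ.+ 0 ℕ.* suc (m ℕ.+ 0 ℕ.* suc m)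
    cross = trans (ℕP.*-identityʳ (m ℕ.* 1)) (trans (ℕP.*-identityʳ m)
              (sym (trans (ℕP.+-identityʳ _) (ℕP.+-identityʳ m))))


module Sums where

  open NatRat
  open import Data.Nat as ℕ using (ℕ; zero; suc; _≤_; _<_; _∸_; z≤n; s≤s)
  import Data.Nat.Properties as ℕP
  open import Data.Fin as Fin using (Fin; toℕ)
  open import Data.Rational as ℚ using (ℚ; 1ℚ)
  import Data.Rational.Properties as ℚP
  open import Data.List using (List; []; _∷_; _++_; map; length; tabulate; allFin)
  open import Data.List.Membership.Propositional using (_∈_)
  open import Data.List.Relation.Unary.Any using (here; there)
  open import Data.List.Relation.Unary.All as All using (All; []; _∷_)
  open import Data.List.Relation.Unary.AllPairs.Core using (AllPairs; []; _∷_)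
  open import Relation.Nullary using (¬_; Dec; yes; no)
  open import Relation.Nullary.Decidable using (map′)
  open import Data.Empty using (⊥-elim)
  open import Algebra.Properties.CommutativeSemigroup ℕP.+-commutativeSemigroup using (interchange)
  open import Function using (_∘_)
  open import Relation.Binary.PropositionalEquality

  𝟙 : ∀ {P : Set} → Dec P → ℕ
  𝟙 (yes _) = 1
  𝟙 (no _) = 0

  𝟙-yes : ∀ {P : Set} (p : Dec P) → P → 𝟙 p ≡ 1
  𝟙-yes (yes _) _ = refl
  𝟙-yes (no ¬x) x = ⊥-elim (¬x x)

  𝟙-no : ∀ {P : Set} (p : Dec P) → ¬ P → 𝟙 p ≡ 0
  𝟙-no (yes x) ¬x = ⊥-elim (¬x x)
  𝟙-no (no _) _ = refl

  𝟙-cong : ∀ {P Q : Set} (p : Dec P) (q : Dec Q) → (P → Q) → (Q → P) → 𝟙 p ≡ 𝟙 q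
  𝟙-cong (yes x) q f g = sym (𝟙-yes q (f x))
  𝟙-cong (no ¬x) q f g = sym (𝟙-no q (λ y → ¬x (g y)))

  𝟙-map′ : ∀ {P Q : Set} (f : P → Q) (g : Q → P) (p : Dec P) → 𝟙 (map′ f g p) ≡ 𝟙 p
  𝟙-map′ f g (yes _) = refl
  𝟙-map′ f g (no _) = refl

  Σℚ : {A : Set} → List A → (A → ℚ) → ℚ
  Σℚ xs g = sumℚ (map g xs)

  Σℚ-cong : {A : Set} (xs : List A) {g h : A → ℚ} → (∀ x → x ∈ xs → g x ≡ h x) → Σℚ xs g ≡ Σℚ xs h
  Σℚ-cong [] e = refl
  Σℚ-cong (x ∷ xs) e = cong₂ ℚ._+_ (e x (here refl)) (Σℚ-cong xs (λ y p → e y (there p)))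

  Σℚ-++ : {A : Set} (xs ys : List A) (g : A → ℚ) → Σℚ (xs ++ ys) g ≡ Σℚ xs g ℚ.+ Σℚ ys g
  Σℚ-++ [] ys g = sym (ℚP.+-identityˡ _)
  Σℚ-++ (x ∷ xs) ys g = trans (cong (g x ℚ.+_) (Σℚ-++ xs ys g)) (sym (ℚP.+-assoc (g x) _ _))

  Σℚ-map : {A B : Set} (xs : List A) (f : A → B) (g : B → ℚ) → Σℚ (map f xs) g ≡ Σℚ xs (λ x → g (f x))
  Σℚ-map [] f g = refl
  Σℚ-map (x ∷ xs) f g = cong (g (f x) ℚ.+_) (Σℚ-map xs f g)

  Σℚ-const : {A : Set} (xs : List A) (c : ℚ) → Σℚ xs (λ _ → c) ≡ fromℕ (length xs) ℚ.* c
  Σℚ-const [] c = sym (ℚP.*-zeroˡ c)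
  Σℚ-const (x ∷ xs) c = begin
    c ℚ.+ Σℚ xs (λ _ → c)                        ≡⟨ cong (c ℚ.+_) (Σℚ-const xs c) ⟩
    c ℚ.+ fromℕ (length xs) ℚ.* c                ≡⟨ cong (ℚ._+ fromℕ (length xs) ℚ.* c) (sym (ℚP.*-identityˡ c)) ⟩
    1ℚ ℚ.* c ℚ.+ fromℕ (length xs) ℚ.* c         ≡⟨ sym (ℚP.*-distribʳ-+ c 1ℚ (fromℕ (length xs))) ⟩
    (1ℚ ℚ.+ fromℕ (length xs)) ℚ.* c             ≡⟨ cong (ℚ._* c) (sym (fromℕ-+ 1 (length xs))) ⟩
    fromℕ (suc (length xs)) ℚ.* c                ∎
    where open ≡-Reasoning

  Σℚ-*ˡ : {A : Set} (xs : List A) (c : ℚ) (g : A → ℚ) → Σℚ xs (λ x → c ℚ.* g x) ≡ c ℚ.* Σℚ xs g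
  Σℚ-*ˡ [] c g = sym (ℚP.*-zeroʳ c)
  Σℚ-*ˡ (x ∷ xs) c g = trans (cong (c ℚ.* g x ℚ.+_) (Σℚ-*ˡ xs c g)) (sym (ℚP.*-distribˡ-+ c (g x) _))

  Σℕ : {A : Set} → List A → (A → ℕ) → ℕ
  Σℕ [] g = 0
  Σℕ (x ∷ xs) g = g x ℕ.+ Σℕ xs g

  Σℕ-cong : {A : Set} (xs : List A) {g h : A → ℕ} → (∀ x → x ∈ xs → g x ≡ h x) → Σℕ xs g ≡ Σℕ xs h
  Σℕ-cong [] e = refl
  Σℕ-cong (x ∷ xs) e = cong₂ ℕ._+_ (e x (here refl)) (Σℕ-cong xs (λ y p → e y (there p)))

  Σℕ-++ : {A : Set} (xs ys : List A) (g : A → ℕ) → Σℕ (xs ++ ys) g ≡ Σℕ xs g ℕ.+ Σℕ ys g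
  Σℕ-++ [] ys g = refl
  Σℕ-++ (x ∷ xs) ys g = trans (cong (g x ℕ.+_) (Σℕ-++ xs ys g)) (sym (ℕP.+-assoc (g x) _ _))

  Σℕ-map : {A B : Set} (xs : List A) (f : A → B) (g : B → ℕ) → Σℕ (map f xs) g ≡ Σℕ xs (λ x → g (f x))
  Σℕ-map [] f g = refl
  Σℕ-map (x ∷ xs) f g = cong (g (f x) ℕ.+_) (Σℕ-map xs f g)

  Σℕ-+ : {A : Set} (xs : List A) (g h : A → ℕ) → Σℕ xs (λ x → g x ℕ.+ h x) ≡ Σℕ xs g ℕ.+ Σℕ xs h
  Σℕ-+ [] g h = refl
  Σℕ-+ (x ∷ xs) g h = trans (cong (g x ℕ.+ h x ℕ.+_) (Σℕ-+ xs g h)) (interchange (g x) (h x) _ _)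

  Σℕ-zero : {A : Set} (xs : List A) → Σℕ xs (λ _ → 0) ≡ 0
  Σℕ-zero [] = refl
  Σℕ-zero (x ∷ xs) = Σℕ-zero xs

  Σℕ-swap : {A B : Set} (xs : List A) (ys : List B) (G : A → B → ℕ) →
    Σℕ xs (λ x → Σℕ ys (G x)) ≡ Σℕ ys (λ y → Σℕ xs (λ x → G x y))
  Σℕ-swap [] ys G = sym (Σℕ-zero ys)
  Σℕ-swap (x ∷ xs) ys G = trans (cong (Σℕ ys (G x) ℕ.+_) (Σℕ-swap xs ys G))
    (sym (Σℕ-+ ys (G x) (λ y → Σℕ xs (λ x → G x y))))

  module Occurrences {A : Set} (_≟_ : (a b : A) → Dec (a ≡ b)) where

    count-absent : ∀ {ρ} (xs : List A) → All (λ τ → ¬ τ ≡ ρ) xs → Σℕ xs (λ σ → 𝟙 (σ ≟ ρ)) ≡ 0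
    count-absent [] [] = refl
    count-absent (x ∷ xs) (p ∷ ps) = cong₂ ℕ._+_ (𝟙-no (x ≟ _) p) (count-absent xs ps)

    count-unique : ∀ {ρ} (xs : List A) → AllPairs (λ a b → ¬ a ≡ b) xs → ρ ∈ xs →
                   Σℕ xs (λ σ → 𝟙 (σ ≟ ρ)) ≡ 1
    count-unique (x ∷ xs) (a ∷ u) (here refl) =
      cong₂ ℕ._+_ (𝟙-yes (x ≟ x) refl) (count-absent xs (All.map (λ ne e → ne (sym e)) a))
    count-unique (x ∷ xs) (a ∷ u) (there p) =
      cong₂ ℕ._+_ (𝟙-no (x ≟ _) (All.lookup a p)) (count-unique xs u p)

  sumBelow : ℕ → (ℕ → ℕ) → ℕ
  sumBelow zero h = 0
  sumBelow (suc n) h = h 0 ℕ.+ sumBelow n (λ i → h (suc i))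

  sumBelow-cong : ∀ n {g h : ℕ → ℕ} → (∀ i → i < n → g i ≡ h i) → sumBelow n g ≡ sumBelow n h
  sumBelow-cong zero e = refl
  sumBelow-cong (suc n) e = cong₂ ℕ._+_ (e 0 (s≤s z≤n)) (sumBelow-cong n (λ i p → e (suc i) (s≤s p)))

  sumBelow-+ : ∀ a b h → sumBelow (a ℕ.+ b) h ≡ sumBelow a h ℕ.+ sumBelow b (λ i → h (a ℕ.+ i))
  sumBelow-+ zero b h = refl
  sumBelow-+ (suc a) b h =
    trans (cong (h 0 ℕ.+_) (sumBelow-+ a b (λ i → h (suc i)))) (sym (ℕP.+-assoc (h 0) _ _))

  sumBelow-zero : ∀ n → sumBelow n (λ _ → 0) ≡ 0
  sumBelow-zero zero = refl
  sumBelow-zero (suc n) = sumBelow-zero n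

  -- A sum over [0,n) is invariant under the cyclic relabelling s ↦ (s - r) mod n,
  -- given here by its values on [0,r) and on [r,n).
  sumBelow-rotate : ∀ n r (ρ h : ℕ → ℕ) → r ≤ n →
    (∀ i → ρ (r ℕ.+ i) ≡ i) → (∀ s → s < r → ρ s ≡ (n ∸ r) ℕ.+ s) →
    sumBelow n (λ s → h (ρ s)) ≡ sumBelow n h
  sumBelow-rotate n r ρ h r≤n ρ-hi ρ-lo = begin
    sumBelow n (h ∘ ρ)
      ≡⟨ cong (λ t → sumBelow t (h ∘ ρ)) (sym (ℕP.m+[n∸m]≡n r≤n)) ⟩
    sumBelow (r ℕ.+ (n ∸ r)) (h ∘ ρ)
      ≡⟨ sumBelow-+ r (n ∸ r) (h ∘ ρ) ⟩
    sumBelow r (h ∘ ρ) ℕ.+ sumBelow (n ∸ r) (λ i → h (ρ (r ℕ.+ i)))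
      ≡⟨ cong₂ ℕ._+_ (sumBelow-cong r (λ s p → cong h (ρ-lo s p)))
                     (sumBelow-cong (n ∸ r) (λ i _ → cong h (ρ-hi i))) ⟩
    sumBelow r (λ i → h ((n ∸ r) ℕ.+ i)) ℕ.+ sumBelow (n ∸ r) h
      ≡⟨ ℕP.+-comm (sumBelow r _) (sumBelow (n ∸ r) h) ⟩
    sumBelow (n ∸ r) h ℕ.+ sumBelow r (λ i → h ((n ∸ r) ℕ.+ i))
      ≡⟨ sym (sumBelow-+ (n ∸ r) r h) ⟩
    sumBelow ((n ∸ r) ℕ.+ r) h
      ≡⟨ cong (λ t → sumBelow t h) (ℕP.m∸n+n≡m r≤n) ⟩
    sumBelow n h
      ∎
    where open ≡-Reasoning

  Σℕ-tabulate : ∀ {A : Set} n (f : Fin n → A) (G : A → ℕ) (h : ℕ → ℕ) →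
    (∀ i → G (f i) ≡ h (toℕ i)) → Σℕ (tabulate f) G ≡ sumBelow n h
  Σℕ-tabulate zero f G h e = refl
  Σℕ-tabulate (suc n) f G h e =
    cong₂ ℕ._+_ (e Fin.zero) (Σℕ-tabulate n (f ∘ Fin.suc) G (h ∘ suc) (e ∘ Fin.suc))

  Σℕ-allFin : ∀ n h → Σℕ (allFin n) (λ j → h (toℕ j)) ≡ sumBelow n h
  Σℕ-allFin n h = Σℕ-tabulate n (λ i → i) (λ j → h (toℕ j)) h (λ _ → refl)


module ClassCount {A : Set} (E : A → A → Set) (E? : ∀ x y → Dec (E x y))
  (E-refl : ∀ x → E x x) (E-sym : ∀ {x y} → E x y → E y x)
  (E-trans : ∀ {x y z} → E x y → E y z → E x z) where

  open NatRat
  open Sums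
  open import Data.Nat as ℕ using (ℕ; zero; suc; _≤_; z≤n; s≤s)
  import Data.Nat.Properties as ℕP
  open import Data.Fin using (Fin; zero; suc)
  open import Data.Rational as ℚ using (ℚ; 0ℚ; 1ℚ; _+_; _*_)
  import Data.Rational.Properties as ℚP
  open import Data.List using (List; []; _∷_; length; lookup)
  open import Data.List.Membership.Propositional using (_∈_)
  open import Data.List.Membership.Propositional.Properties using (∈-lookup)
  open import Data.List.Relation.Unary.Any using (Any; here; there)
  open import Data.List.Relation.Unary.All as All using ()
  open import Data.List.Relation.Unary.AllPairs.Core using (AllPairs; []; _∷_)
  open import Data.Product using (_×_; _,_; proj₁; proj₂)
  open import Relation.Nullary using (¬_; Dec; yes; no)
  open import Data.Empty using (⊥-elim)
  open import Relation.Binary.PropositionalEquality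

  classSize : A → List A → ℕ
  classSize z [] = 0
  classSize z (w ∷ ws) = 𝟙 (E? z w) ℕ.+ classSize z ws

  classSize-Σℕ : ∀ z ws → classSize z ws ≡ Σℕ ws (λ w → 𝟙 (E? z w))
  classSize-Σℕ z [] = refl
  classSize-Σℕ z (w ∷ ws) = cong (𝟙 (E? z w) ℕ.+_) (classSize-Σℕ z ws)

  dropClass : A → List A → List A
  dropClass y [] = []
  dropClass y (z ∷ zs) with E? y z
  ... | yes _ = dropClass y zs
  ... | no _ = z ∷ dropClass y zs

  onClass : A → A → ℚ → ℚ
  onClass y z q with E? y z
  ... | yes _ = q
  ... | no _ = 0ℚ

  Σℚ-splitClass : ∀ y zs (g : A → ℚ) → Σℚ zs g ≡ Σℚ zs (λ z → onClass y z (g z)) + Σℚ (dropClass y zs) g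
  Σℚ-splitClass y [] g = sym (ℚP.+-identityˡ 0ℚ)
  Σℚ-splitClass y (z ∷ zs) g with E? y z
  ... | yes _ = trans (cong (g z +_) (Σℚ-splitClass y zs g)) (sym (ℚP.+-assoc (g z) _ _))
  ... | no _ = trans (cong (g z +_) (Σℚ-splitClass y zs g)) (swap (g z) (Σℚ zs (λ w → onClass y w (g w))) (Σℚ (dropClass y zs) g))
    where
    swap : ∀ a b c → a + (b + c) ≡ (0ℚ + b) + (a + c)
    swap a b c = trans (sym (ℚP.+-assoc a b c)) (trans (cong (_+ c) (ℚP.+-comm a b))
      (trans (ℚP.+-assoc b a c) (cong (_+ (a + c)) (sym (ℚP.+-identityˡ b)))))

  Σℚ-onClass-const : ∀ y zs c → Σℚ zs (λ z → onClass y z c) ≡ fromℕ (classSize y zs) * c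
  Σℚ-onClass-const y [] c = sym (ℚP.*-zeroˡ c)
  Σℚ-onClass-const y (z ∷ zs) c with E? y z
  ... | yes _ = begin
    c + Σℚ zs (λ z → onClass y z c)          ≡⟨ cong (c +_) (Σℚ-onClass-const y zs c) ⟩
    c + fromℕ (classSize y zs) * c           ≡⟨ cong (_+ fromℕ (classSize y zs) * c) (sym (ℚP.*-identityˡ c)) ⟩
    1ℚ * c + fromℕ (classSize y zs) * c      ≡⟨ sym (ℚP.*-distribʳ-+ c 1ℚ (fromℕ (classSize y zs))) ⟩
    (1ℚ + fromℕ (classSize y zs)) * c        ≡⟨ cong (_* c) (sym (fromℕ-+ 1 (classSize y zs))) ⟩
    fromℕ (suc (classSize y zs)) * c         ∎
    where open ≡-Reasoning
  ... | no _ = trans (ℚP.+-identityˡ _) (Σℚ-onClass-const y zs c)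

  Σℚ-onClass-cong : ∀ y zs (g h : A → ℚ) → (∀ z → E y z → g z ≡ h z) →
    Σℚ zs (λ z → onClass y z (g z)) ≡ Σℚ zs (λ z → onClass y z (h z))
  Σℚ-onClass-cong y [] g h e = refl
  Σℚ-onClass-cong y (z ∷ zs) g h e with E? y z
  ... | yes p = cong₂ _+_ (e z p) (Σℚ-onClass-cong y zs g h e)
  ... | no _ = cong (0ℚ +_) (Σℚ-onClass-cong y zs g h e)

  classSize-resp : ∀ {y z} → E y z → ∀ ws → classSize z ws ≡ classSize y ws
  classSize-resp e [] = refl
  classSize-resp e (w ∷ ws) =
    cong₂ ℕ._+_ (𝟙-cong _ _ (E-trans e) (E-trans (E-sym e))) (classSize-resp e ws)

  classSize-dropClass : ∀ {y z} → ¬ E y z → ∀ ws → classSize z ws ≡ classSize z (dropClass y ws)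
  classSize-dropClass ne [] = refl
  classSize-dropClass {y} {z} ne (w ∷ ws) with E? y w
  ... | yes p = trans (cong (ℕ._+ classSize z ws) (𝟙-no (E? z w) (λ q → ne (E-trans p (E-sym q)))))
                      (classSize-dropClass ne ws)
  ... | no _ = cong (𝟙 (E? z w) ℕ.+_) (classSize-dropClass ne ws)

  ∈-dropClass⁻ : ∀ {y z} ws → z ∈ dropClass y ws → z ∈ ws × ¬ E y z
  ∈-dropClass⁻ {y} (w ∷ ws) p with E? y w
  ... | yes _ = let (a , b) = ∈-dropClass⁻ ws p in there a , b
  ∈-dropClass⁻ {y} (w ∷ ws) (here refl) | no ne = here refl , ne
  ∈-dropClass⁻ {y} (w ∷ ws) (there p) | no _ = let (a , b) = ∈-dropClass⁻ ws p in there a , b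

  ∈-dropClass⁺ : ∀ {y z} ws → z ∈ ws → ¬ E y z → z ∈ dropClass y ws
  ∈-dropClass⁺ {y} (w ∷ ws) p ne with E? y w
  ∈-dropClass⁺ {y} (w ∷ ws) (here refl) ne | yes e = ⊥-elim (ne e)
  ∈-dropClass⁺ {y} (w ∷ ws) (there p) ne | yes e = ∈-dropClass⁺ ws p ne
  ∈-dropClass⁺ {y} (w ∷ ws) (here refl) ne | no _ = here refl
  ∈-dropClass⁺ {y} (w ∷ ws) (there p) ne | no _ = there (∈-dropClass⁺ ws p ne)

  length-dropClass : ∀ y ws → length (dropClass y ws) ≤ length ws
  length-dropClass y [] = z≤n
  length-dropClass y (w ∷ ws) with E? y w
  ... | yes _ = ℕP.m≤n⇒m≤1+n (length-dropClass y ws)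
  ... | no _ = s≤s (length-dropClass y ws)

  dropClass-self : ∀ y ws → dropClass y (y ∷ ws) ≡ dropClass y ws
  dropClass-self y ws with E? y y
  ... | yes _ = refl
  ... | no ne = ⊥-elim (ne (E-refl y))

  reps : ℕ → List A → List A
  reps zero _ = []
  reps (suc f) [] = []
  reps (suc f) (y ∷ ys) = y ∷ reps f (dropClass y ys)

  representatives : List A → List A
  representatives xs = reps (length xs) xs

  -- Σ_{z ∈ ys} 1/classSize z ys: every class contributes exactly 1.
  weight : List A → ℚ
  weight ys = Σℚ ys (λ z → recip (classSize z ys))

  weight-reps : ∀ f ys → length ys ≤ f → weight ys ≡ fromℕ (length (reps f ys))
  weight-reps zero [] _ = refl
  weight-reps (suc f) [] _ = refl
  weight-reps (suc f) (y ∷ ys) (s≤s l) =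
    trans (Σℚ-splitClass y Y w)
     (trans (cong₂ _+_ classOfY rest) (sym (fromℕ-+ 1 (length (reps f O)))))
    where
    Y O : List A
    Y = y ∷ ys
    O = dropClass y ys
    w : A → ℚ
    w z = recip (classSize z Y)
    m : ℕ
    m = classSize y ys
    size-y : classSize y Y ≡ suc m
    size-y = cong (ℕ._+ m) (𝟙-yes (E? y y) (E-refl y))
    classOfY : Σℚ Y (λ z → onClass y z (w z)) ≡ 1ℚ
    classOfY = begin
      Σℚ Y (λ z → onClass y z (w z))               ≡⟨ Σℚ-onClass-cong y Y w (λ _ → recip (suc m))
                                                        (λ z e → cong recip (trans (classSize-resp e Y) size-y)) ⟩
      Σℚ Y (λ z → onClass y z (recip (suc m)))     ≡⟨ Σℚ-onClass-const y Y (recip (suc m)) ⟩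
      fromℕ (classSize y Y) * recip (suc m)        ≡⟨ cong (λ t → fromℕ t * recip (suc m)) size-y ⟩
      fromℕ (suc m) * recip (suc m)                ≡⟨ fromℕ-*-recip m ⟩
      1ℚ                                           ∎
      where open ≡-Reasoning
    -- outside the class of y, class sizes in Y and in O agree
    rest : Σℚ (dropClass y Y) w ≡ fromℕ (length (reps f O))
    rest = trans (cong (λ t → Σℚ t w) (dropClass-self y ys))
      (trans (Σℚ-cong O (λ z p → cong recip
          (trans (cong (ℕ._+ classSize z ys) (𝟙-no (E? z y) (λ e → proj₂ (∈-dropClass⁻ ys p) (E-sym e))))
                 (classSize-dropClass (proj₂ (∈-dropClass⁻ ys p)) ys))))
       (weight-reps f O (ℕP.≤-trans (length-dropClass y ys) l)))

  weight≡#representatives : ∀ xs → weight xs ≡ fromℕ (length (representatives xs))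
  weight≡#representatives xs = weight-reps (length xs) xs ℕP.≤-refl

  reps-⊆ : ∀ f ys {z} → z ∈ reps f ys → z ∈ ys
  reps-⊆ (suc f) (y ∷ ys) (here refl) = here refl
  reps-⊆ (suc f) (y ∷ ys) (there p) = there (proj₁ (∈-dropClass⁻ ys (reps-⊆ f (dropClass y ys) p)))

  reps-inequivalent : ∀ f ys → AllPairs (λ a b → ¬ E a b) (reps f ys)
  reps-inequivalent zero ys = []
  reps-inequivalent (suc f) [] = []
  reps-inequivalent (suc f) (y ∷ ys) =
    All.tabulate (λ p → proj₂ (∈-dropClass⁻ ys (reps-⊆ f (dropClass y ys) p)))
      ∷ reps-inequivalent f (dropClass y ys)

  reps-cover : ∀ f ys → length ys ≤ f → ∀ {z} → z ∈ ys → Any (λ w → E w z) (reps f ys)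
  reps-cover (suc f) (y ∷ ys) l (here refl) = here (E-refl y)
  reps-cover (suc f) (y ∷ ys) (s≤s l) {z} (there p) with E? y z
  ... | yes e = here e
  ... | no ne = there (reps-cover f (dropClass y ys) (ℕP.≤-trans (length-dropClass y ys) l)
                                   (∈-dropClass⁺ ys p ne))

  representatives-⊆ : ∀ xs {z} → z ∈ representatives xs → z ∈ xs
  representatives-⊆ xs = reps-⊆ (length xs) xs

  representatives-cover : ∀ xs {z} → z ∈ xs → Any (λ w → E w z) (representatives xs)
  representatives-cover xs = reps-cover (length xs) xs ℕP.≤-refl

  representatives-injective : ∀ xs (i j : Fin (length (representatives xs))) →
    E (lookup (representatives xs) i) (lookup (representatives xs) j) → i ≡ j
  representatives-injective xs = lookup-injective (representatives xs) (reps-inequivalent (length xs) xs)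
    where
    lookup-injective : ∀ ys → AllPairs (λ a b → ¬ E a b) ys → ∀ i j → E (lookup ys i) (lookup ys j) → i ≡ j
    lookup-injective (y ∷ ys) (a ∷ ap) zero zero e = refl
    lookup-injective (y ∷ ys) (a ∷ ap) zero (suc j) e = ⊥-elim (All.lookup a (∈-lookup j) e)
    lookup-injective (y ∷ ys) (a ∷ ap) (suc i) zero e = ⊥-elim (All.lookup a (∈-lookup i) (E-sym e))
    lookup-injective (y ∷ ys) (a ∷ ap) (suc i) (suc j) e = cong suc (lookup-injective ys ap i j e)


-- Permutations read as functions on ℕ: `val π x` is π(x) for x < n (0-indexed) and 0 otherwise.
-- Working with ℕ-valued positions avoids most Fin bookkeeping in what follows.
module Values where

  open import Data.Nat as ℕ using (ℕ; zero; suc; _≤_; _<_; _+_; _∸_; _<?_)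
  open import Data.Nat.Properties
  open import Data.Fin as Fin using (Fin; toℕ; fromℕ<; _↑ˡ_; _↑ʳ_; reduce≥)
  open import Data.Fin.Properties using (toℕ-injective; toℕ-fromℕ<; fromℕ<-toℕ; toℕ<n; splitAt-<; splitAt-≥; toℕ-↑ˡ; toℕ-↑ʳ)
  open import Data.Vec using (lookup; tabulate)
  open import Data.Vec.Properties using (lookup∘tabulate; tabulate∘lookup; tabulate-cong)
  open import Data.Product using (Σ; _×_; _,_)
  open import Data.Sum using (_⊎_; inj₁; inj₂; [_,_])
  open import Relation.Nullary using (yes; no)
  open import Data.Empty using (⊥-elim)
  open import Relation.Binary.PropositionalEquality hiding ([_])

  val : ∀ {n} → Perm n → ℕ → ℕ
  val {n} π x with x <? n
  ... | yes p = toℕ (lookup π (fromℕ< p))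
  ... | no _ = 0

  val-toℕ : ∀ {n} (π : Perm n) (i : Fin n) → val π (toℕ i) ≡ toℕ (lookup π i)
  val-toℕ {n} π i with toℕ i <? n
  ... | yes p = cong (λ j → toℕ (lookup π j)) (fromℕ<-toℕ i p)
  ... | no ¬p = ⊥-elim (¬p (toℕ<n i))

  val-fromℕ< : ∀ {n} (π : Perm n) {x} (p : x < n) → val π x ≡ toℕ (lookup π (fromℕ< p))
  val-fromℕ< π {x} p = trans (cong (val π) (sym (toℕ-fromℕ< p))) (val-toℕ π (fromℕ< p))

  val-< : ∀ {n} (π : Perm n) {x} → x < n → val π x < n
  val-< π p rewrite val-fromℕ< π p = toℕ<n _

  val-ext : ∀ {n} (π σ : Perm n) → (∀ x → x < n → val π x ≡ val σ x) → π ≡ σ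
  val-ext π σ h = trans (sym (tabulate∘lookup π)) (trans (tabulate-cong λ i →
    toℕ-injective (trans (sym (val-toℕ π i)) (trans (h (toℕ i) (toℕ<n i)) (val-toℕ σ i))))
    (tabulate∘lookup σ))

  fromVal : (n : ℕ) (g : ℕ → ℕ) → (∀ x → x < n → g x < n) → Perm n
  fromVal n g h = tabulate (λ i → fromℕ< (h (toℕ i) (toℕ<n i)))

  val-fromVal : ∀ n g h {x} → x < n → val (fromVal n g h) x ≡ g x
  val-fromVal n g h {x} p = trans (val-fromℕ< (fromVal n g h) p)
    (trans (cong toℕ (lookup∘tabulate _ (fromℕ< p)))
    (trans (toℕ-fromℕ< _) (cong g (toℕ-fromℕ< p))))

  ValInjective : ∀ {n} → Perm n → Set
  ValInjective {n} π = ∀ x y → x < n → y < n → val π x ≡ val π y → x ≡ y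

  isPerm⇒valInjective : ∀ {n} {π : Perm n} → IsPerm π → ValInjective π
  isPerm⇒valInjective {n} {π} ip x y px py e =
    trans (sym (toℕ-fromℕ< px)) (trans (cong toℕ (ip (fromℕ< px) (fromℕ< py)
      (toℕ-injective (trans (sym (val-fromℕ< π px)) (trans e (val-fromℕ< π py)))))) (toℕ-fromℕ< py))

  valInjective⇒isPerm : ∀ {n} {π : Perm n} → ValInjective π → IsPerm π
  valInjective⇒isPerm {n} {π} h i j e = toℕ-injective (h (toℕ i) (toℕ j) (toℕ<n i) (toℕ<n j)
    (trans (val-toℕ π i) (trans (cong toℕ e) (sym (val-toℕ π j)))))

  toℕ-reduce≥ : ∀ {m n} (i : Fin (m + n)) .(p : m ≤ toℕ i) → toℕ (reduce≥ i p) ≡ toℕ i ∸ m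
  toℕ-reduce≥ {zero} i p = refl
  toℕ-reduce≥ {suc m} (Fin.suc i) p = toℕ-reduce≥ {m} i (≤-pred p)

  val-⊕ˡ : ∀ {a b} (σ : Perm a) (τ : Perm b) {x} → x < a → val (σ ⊕ τ) x ≡ val σ x
  val-⊕ˡ {a} {b} σ τ {x} p =
    trans (val-fromℕ< (σ ⊕ τ) q) (trans (cong toℕ (lookup∘tabulate _ (fromℕ< q)))
     (trans (cong (λ s → toℕ ([ (λ y → lookup σ y ↑ˡ b) , (λ y → a ↑ʳ lookup τ y) ] s))
        (splitAt-< a (fromℕ< q) r))
     (trans (toℕ-↑ˡ (lookup σ (fromℕ< r)) b) (sym (trans (val-fromℕ< σ p) (cong (λ j → toℕ (lookup σ j))
        (toℕ-injective (trans (toℕ-fromℕ< p) (sym (trans (toℕ-fromℕ< r) (toℕ-fromℕ< q)))))))))))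
    where
    q : x < a + b
    q = <-≤-trans p (m≤m+n a b)
    r : toℕ (fromℕ< q) < a
    r = subst (_< a) (sym (toℕ-fromℕ< q)) p

  val-⊕ʳ : ∀ {a b} (σ : Perm a) (τ : Perm b) {y} → y < b → val (σ ⊕ τ) (a + y) ≡ a + val τ y
  val-⊕ʳ {a} {b} σ τ {y} p =
    trans (val-fromℕ< (σ ⊕ τ) q) (trans (cong toℕ (lookup∘tabulate _ (fromℕ< q)))
     (trans (cong (λ s → toℕ ([ (λ y → lookup σ y ↑ˡ b) , (λ y → a ↑ʳ lookup τ y) ] s))
        (splitAt-≥ a (fromℕ< q) ge))
     (trans (toℕ-↑ʳ a _) (cong (a +_) (sym (trans (val-fromℕ< τ p) (cong (λ j → toℕ (lookup τ j))
        (toℕ-injective (trans (toℕ-fromℕ< p) (sym (trans (toℕ-reduce≥ (fromℕ< q) ge)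
           (trans (cong (_∸ a) (toℕ-fromℕ< q)) (m+n∸m≡n a y)))))))))))))
    where
    q : a + y < a + b
    q = +-monoʳ-< a p
    ge : a ≤ toℕ (fromℕ< q)
    ge = subst (a ≤_) (sym (toℕ-fromℕ< q)) (m≤m+n a y)

  split< : ∀ a {b x} → x < a + b → x < a ⊎ Σ ℕ (λ y → y < b × x ≡ a + y)
  split< a {b} {x} p with x <? a
  ... | yes q = inj₁ q
  ... | no ¬q = inj₂ (x ∸ a , +-cancelˡ-< a (x ∸ a) b (subst (_< a + b) (sym (m+[n∸m]≡n (≮⇒≥ ¬q))) p)
                             , sym (m+[n∸m]≡n (≮⇒≥ ¬q)))

  val-subst : ∀ {a b} (e : a ≡ b) (P : Perm a) x → val (subst Perm e P) x ≡ val P x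
  val-subst refl P x = refl

  subst-Perm : ∀ {b c m} (e : b + c ≡ m) (P : Perm (b + c)) (Q : Perm m) →
    (∀ x → x < m → val P x ≡ val Q x) → subst Perm e P ≡ Q
  subst-Perm refl P Q h = val-ext P Q h


-- Cuts.  c ∈ [0,n] is a cut of π ∈ Sₙ when π maps [0,c) onto itself, i.e. x < c ⇔ π(x) < c.
-- At a cut, π splits as α ⊕ β with |α| = c, and β ⊕ α is the rotation of π at c.
-- The cuts of π in [0,n) are exactly the starting points of its blocks.
module Cuts where

  open Values
  open Sums
  open import Data.Nat as ℕ using (ℕ; zero; suc; _≤_; _<_; _+_; _∸_; z≤n; s≤s; _<?_; _≤?_)
  open import Data.Nat.Properties
  open import Data.Product using (Σ; _×_; _,_; proj₁; proj₂)
  open import Data.Sum using (_⊎_; inj₁; inj₂)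
  open import Relation.Nullary using (¬_; yes; no)
  open import Relation.Nullary.Decidable using (_×-dec_; _→-dec_; map′)
  open import Data.Fin as Fin using ()
  open import Data.Vec.Properties using (≡-dec)
  open import Data.List using (List)
  open import Data.List.Membership.Propositional using (_∈_)
  open import Data.List.Relation.Unary.AllPairs.Core using (AllPairs)
  open import Data.Empty using (⊥-elim)
  open import Relation.Binary.PropositionalEquality hiding ([_])

  Cut : ∀ {n} → Perm n → ℕ → Set
  Cut {n} π c = c ≤ n × (∀ x → x < n → (x < c → val π x < c) × (val π x < c → x < c))

  all<? : (n : ℕ) {P : ℕ → Set} → (∀ x → Dec (P x)) → Dec (∀ x → x < n → P x)
  all<? zero P? = yes (λ x ())
  all<? (suc n) {P} P? with all<? n P? | P? n
  ... | no ¬h | _ = no (λ h → ¬h (λ x x<n → h x (m≤n⇒m≤1+n x<n)))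
  ... | yes h | no ¬p = no (λ h' → ¬p (h' n ≤-refl))
  ... | yes h | yes p = yes (λ x x<1+n → cases (m<1+n⇒m<n∨m≡n x<1+n))
    where
    cases : ∀ {x} → x < n ⊎ x ≡ n → P x
    cases {x} (inj₁ q) = h x q
    cases (inj₂ refl) = p

  cut? : ∀ {n} (π : Perm n) c → Dec (Cut π c)
  cut? {n} π c =
    (c ≤? n) ×-dec all<? n (λ x → ((x <? c) →-dec (val π x <? c)) ×-dec ((val π x <? c) →-dec (x <? c)))

  cut-0 : ∀ {n} (π : Perm n) → Cut π 0
  cut-0 π = z≤n , λ x _ → (λ ()) , (λ ())

  cutCount : ∀ {n} → Perm n → ℕ
  cutCount {n} π = sumBelow n (λ c → 𝟙 (cut? π c))

  module Split {n} (π : Perm n) (c : ℕ) (h : Cut π c) where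

    c≤n : c ≤ n
    c≤n = proj₁ h

    α-< : ∀ x → x < c → val π x < c
    α-< x p = proj₁ (proj₂ h x (<-≤-trans p c≤n)) p

    α : Perm c
    α = fromVal c (val π) α-<

    shifted-< : ∀ {y} → y < n ∸ c → c + y < n
    shifted-< p = subst (_ <_) (m+[n∸m]≡n c≤n) (+-monoʳ-< c p)

    c≤val : ∀ y → c + y < n → c ≤ val π (c + y)
    c≤val y p = ≮⇒≥ (λ q → <⇒≱ (proj₂ (proj₂ h (c + y) p) q) (m≤m+n c y))

    β-< : ∀ y → y < n ∸ c → val π (c + y) ∸ c < n ∸ c
    β-< y p = ∸-monoˡ-< (val-< π (shifted-< p)) (c≤val y (shifted-< p))

    β : Perm (n ∸ c)
    β = fromVal (n ∸ c) (λ y → val π (c + y) ∸ c) β-<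

    val-α : ∀ {x} → x < c → val α x ≡ val π x
    val-α p = val-fromVal c (val π) α-< p

    val-β : ∀ {y} → y < n ∸ c → c + val β y ≡ val π (c + y)
    val-β p = trans (cong (c +_) (val-fromVal _ _ β-< p)) (m+[n∸m]≡n (c≤val _ (shifted-< p)))

    α-injective : ValInjective π → ValInjective α
    α-injective inj x y px py e = inj x y (<-≤-trans px c≤n) (<-≤-trans py c≤n)
      (trans (sym (val-α px)) (trans e (val-α py)))

    β-injective : ValInjective π → ValInjective β
    β-injective inj x y px py e = +-cancelˡ-≡ c x y (inj (c + x) (c + y) (shifted-< px) (shifted-< py)
      (trans (sym (val-β px)) (trans (cong (c +_) e) (val-β py))))

    α⊕β : subst Perm (m+[n∸m]≡n c≤n) (α ⊕ β) ≡ π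
    α⊕β = subst-Perm {c} {n ∸ c} (m+[n∸m]≡n c≤n) (α ⊕ β) π cases
      where
      cases : ∀ x → x < n → val (α ⊕ β) x ≡ val π x
      cases x p with split< c (subst (x <_) (sym (m+[n∸m]≡n c≤n)) p)
      ... | inj₁ q = trans (val-⊕ˡ α β q) (val-α q)
      ... | inj₂ (y , y<b , refl) = trans (val-⊕ʳ α β y<b) (val-β y<b)

    rotate : Perm n
    rotate = subst Perm (m∸n+n≡m c≤n) (β ⊕ α)

    val-rotate-lo : ∀ {y} → y < n ∸ c → c + val rotate y ≡ val π (c + y)
    val-rotate-lo p = trans (cong (c +_) (trans (val-subst (m∸n+n≡m c≤n) (β ⊕ α) _) (val-⊕ˡ β α p))) (val-β p)

    val-rotate-hi : ∀ {x} → x < c → val rotate ((n ∸ c) + x) ≡ (n ∸ c) + val π x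
    val-rotate-hi p = trans (val-subst (m∸n+n≡m c≤n) (β ⊕ α) _)
      (trans (val-⊕ʳ β α p) (cong ((n ∸ c) +_) (val-α p)))

  open Split public using (rotate)

  rotate-irrelevant : ∀ {n} (π : Perm n) c (h h' : Cut π c) → rotate π c h ≡ rotate π c h'
  rotate-irrelevant π c (p , _) (p' , _) rewrite ≤-irrelevant p p' = refl

  RotatedAt : ∀ {n} → Perm n → ℕ → Perm n → Set
  RotatedAt π d σ = Σ (Cut π d) λ h → σ ≡ rotate π d h

  _≟ₚ_ : ∀ {n} (σ ρ : Perm n) → Dec (σ ≡ ρ)
  _≟ₚ_ = ≡-dec Fin._≟_

  rotatedAt? : ∀ {n} {π : Perm n} {d} → Dec (Cut π d) → ∀ σ → Dec (RotatedAt π d σ)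
  rotatedAt? {π = π} {d} (yes h) σ =
    map′ (h ,_) (λ (h' , e) → trans e (rotate-irrelevant π d h' h)) (σ ≟ₚ rotate π d h)
  rotatedAt? (no ¬h) σ = no (λ (h , _) → ¬h h)

  count-rotatedAt : ∀ {n} (π : Perm n) d (L : List (Perm n)) → AllPairs (λ a b → ¬ a ≡ b) L →
    (∀ h → rotate π d h ∈ L) → (d? : Dec (Cut π d)) → Σℕ L (λ σ → 𝟙 (rotatedAt? d? σ)) ≡ 𝟙 d?
  count-rotatedAt π d L distinct rotations∈L (yes h) =
    trans (Σℕ-cong L (λ σ _ → 𝟙-map′ _ _ (σ ≟ₚ rotate π d h)))
          (Occurrences.count-unique _≟ₚ_ L distinct (rotations∈L h))
  count-rotatedAt π d L _ _ (no _) = Σℕ-zero L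

  indecomposable-noCut : ∀ {a} (σ : Perm a) → Indecomposable σ → ∀ c → 1 ≤ c → c < a → ¬ Cut σ c
  indecomposable-noCut {a} σ (ip , _ , nd) c 1≤c c<a h =
    nd c (a ∸ c) α β (m+[n∸m]≡n c≤n) 1≤c (m<n⇒0<n∸m c<a)
       (valInjective⇒isPerm (α-injective (isPerm⇒valInjective ip)))
       (valInjective⇒isPerm (β-injective (isPerm⇒valInjective ip))) α⊕β
    where open Split σ c h

  cutCount-indecomposable : ∀ {a} (σ : Perm a) → Indecomposable σ → cutCount σ ≡ 1
  cutCount-indecomposable {zero} σ (_ , () , _)
  cutCount-indecomposable {suc a} σ I =
    cong₂ ℕ._+_ (𝟙-yes (cut? σ 0) (cut-0 σ))
      (trans (sumBelow-cong a (λ i i<a → 𝟙-no (cut? σ (suc i))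
                (indecomposable-noCut σ I (suc i) (s≤s z≤n) (s≤s i<a))))
             (sumBelow-zero a))

  module _ {a b} (σ : Perm a) (τ : Perm b) where

    cut-⊕ˡ : ∀ c → c < a → Cut (σ ⊕ τ) c → Cut σ c
    cut-⊕ˡ c c<a (_ , h) = <⇒≤ c<a , body
      where
      body : ∀ x → x < a → (x < c → val σ x < c) × (val σ x < c → x < c)
      body x p with h x (<-≤-trans p (m≤m+n a b))
      ... | r rewrite val-⊕ˡ σ τ p = r

    ⊕-cutˡ : ∀ c → c < a → Cut σ c → Cut (σ ⊕ τ) c
    ⊕-cutˡ c c<a (_ , h) = ≤-trans (<⇒≤ c<a) (m≤m+n a b) , body
      where
      body : ∀ x → x < a + b → (x < c → val (σ ⊕ τ) x < c) × (val (σ ⊕ τ) x < c → x < c)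
      body x p with split< a p
      ... | inj₁ q rewrite val-⊕ˡ σ τ q = h x q
      ... | inj₂ (y , y<b , refl) rewrite val-⊕ʳ σ τ y<b =
            (λ r → ⊥-elim (<⇒≱ r (≤-trans (<⇒≤ c<a) (m≤m+n a y))))
          , (λ r → ⊥-elim (<⇒≱ r (≤-trans (<⇒≤ c<a) (m≤m+n a (val τ y)))))

    cut-⊕ʳ : ∀ d → Cut (σ ⊕ τ) (a + d) → Cut τ d
    cut-⊕ʳ d (ad≤ab , h) = +-cancelˡ-≤ a d b ad≤ab , body
      where
      body : ∀ y → y < b → (y < d → val τ y < d) × (val τ y < d → y < d)
      body y p with h (a + y) (+-monoʳ-< a p)
      ... | r rewrite val-⊕ʳ σ τ p =
            (λ q → +-cancelˡ-< a (val τ y) d (proj₁ r (+-monoʳ-< a q)))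
          , (λ q → +-cancelˡ-< a y d (proj₂ r (+-monoʳ-< a q)))

    ⊕-cutʳ : ∀ d → Cut τ d → Cut (σ ⊕ τ) (a + d)
    ⊕-cutʳ d (d≤b , h) = +-monoʳ-≤ a d≤b , body
      where
      body : ∀ x → x < a + b → (x < a + d → val (σ ⊕ τ) x < a + d) × (val (σ ⊕ τ) x < a + d → x < a + d)
      body x p with split< a p
      ... | inj₁ q rewrite val-⊕ˡ σ τ q =
            (λ _ → <-≤-trans (val-< σ q) (m≤m+n a d)) , (λ _ → <-≤-trans q (m≤m+n a d))
      ... | inj₂ (y , y<b , refl) rewrite val-⊕ʳ σ τ y<b =
            (λ r → +-monoʳ-< a (proj₁ (h y y<b) (+-cancelˡ-< a y d r)))
          , (λ r → +-monoʳ-< a (proj₂ (h y y<b) (+-cancelˡ-< a (val τ y) d r)))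

    cutCount-⊕ : cutCount (σ ⊕ τ) ≡ cutCount σ + cutCount τ
    cutCount-⊕ = trans (sumBelow-+ a b _) (cong₂ _+_
      (sumBelow-cong a (λ c c<a → 𝟙-cong _ _ (cut-⊕ˡ c c<a) (⊕-cutˡ c c<a)))
      (sumBelow-cong b (λ d _ → 𝟙-cong _ _ (cut-⊕ʳ d) (⊕-cutʳ d))))

  blocks≡cutCount : ∀ {n π k} → HasBlocks n π k → cutCount π ≡ k
  blocks≡cutCount nil = refl
  blocks≡cutCount (cons σ τ I hb) =
    trans (cutCount-⊕ σ τ) (cong₂ ℕ._+_ (cutCount-indecomposable σ I) (blocks≡cutCount hb))


-- Membership in a class: patterns of members are members, hence so are the two halves
-- of a member split at a cut, and (by sum closure) its rotations.
module Closure (𝒞 : PermClass) where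

  open Values
  open Cuts
  open import Data.Nat as ℕ using (ℕ; _≤_; _<_; _+_; _∸_)
  open import Data.Nat.Properties
  open import Data.Fin as Fin using (Fin; toℕ; fromℕ<)
  open import Data.Fin.Properties using (toℕ-fromℕ<; toℕ<n)
  open import Data.Vec using (lookup)
  open import Data.Product using (_,_)
  open import Function.Bundles using (_⇔_; mk⇔)
  open import Relation.Binary using (tri<; tri≈; tri>)
  open import Data.Empty using (⊥-elim)
  open import Relation.Binary.PropositionalEquality

  pattern-∈ : ∀ {m k} (P : Perm m) (σ : Perm k) (g : ℕ → ℕ) (c : ℕ) → C 𝒞 m P →
    (∀ x → x < k → g x < m) → (∀ x y → x < y → y < k → g x < g y) →
    (∀ x → x < k → c + val σ x ≡ val P (g x)) → C 𝒞 k σ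
  pattern-∈ {m} {k} P σ g c P∈𝒞 g-< g-mono shifted =
    closed 𝒞 (valInjective⇒isPerm σ-injective) (f , f-mono , f-order) P∈𝒞
    where
    f : Fin k → Fin m
    f i = fromℕ< (g-< (toℕ i) (toℕ<n i))
    toℕ-f : ∀ i → toℕ (f i) ≡ g (toℕ i)
    toℕ-f i = toℕ-fromℕ< _
    f-mono : ∀ i j → i Fin.< j → f i Fin.< f j
    f-mono i j p = subst₂ _<_ (sym (toℕ-f i)) (sym (toℕ-f j)) (g-mono (toℕ i) (toℕ j) p (toℕ<n j))
    P∘f : ∀ i → toℕ (lookup P (f i)) ≡ c + toℕ (lookup σ i)
    P∘f i = trans (sym (val-toℕ P (f i))) (trans (cong (val P) (toℕ-f i))
              (trans (sym (shifted (toℕ i) (toℕ<n i))) (cong (c +_) (val-toℕ σ i))))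
    f-order : ∀ i j → (lookup σ i Fin.< lookup σ j) ⇔ (lookup P (f i) Fin.< lookup P (f j))
    f-order i j = mk⇔
      (λ q → subst₂ _<_ (sym (P∘f i)) (sym (P∘f j)) (+-monoʳ-< c q))
      (λ q → +-cancelˡ-< c _ _ (subst₂ _<_ (P∘f i) (P∘f j) q))
    g-injective : ∀ x y → x < k → y < k → g x ≡ g y → x ≡ y
    g-injective x y px py e with <-cmp x y
    ... | tri< a _ _ = ⊥-elim (<-irrefl e (g-mono x y a py))
    ... | tri≈ _ b _ = b
    ... | tri> _ _ b = ⊥-elim (<-irrefl (sym e) (g-mono y x b px))
    σ-injective : ValInjective σ
    σ-injective x y px py e = g-injective x y px py
      (isPerm⇒valInjective (isPerm 𝒞 P∈𝒞) (g x) (g y) (g-< x px) (g-< y py)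
        (trans (sym (shifted x px)) (trans (cong (c +_) e) (shifted y py))))

  subst-∈ : ∀ {a b} (e : a ≡ b) {P : Perm a} → C 𝒞 a P → C 𝒞 b (subst Perm e P)
  subst-∈ refl P∈𝒞 = P∈𝒞

  rotate-∈ : SumClosed 𝒞 → ∀ {n} {π : Perm n} {c} (h : Cut π c) → C 𝒞 n π → C 𝒞 n (rotate π c h)
  rotate-∈ sum-closed {n} {π} {c} h π∈𝒞 = subst-∈ (m∸n+n≡m c≤n) (sum-closed β∈𝒞 α∈𝒞)
    where
    open Split π c h
    α∈𝒞 : C 𝒞 c α
    α∈𝒞 = pattern-∈ π α (λ x → x) 0 π∈𝒞 (λ x x<c → <-≤-trans x<c c≤n) (λ x y x<y _ → x<y)
            (λ x x<c → val-α x<c)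
    β∈𝒞 : C 𝒞 (n ∸ c) β
    β∈𝒞 = pattern-∈ π β (c +_) c π∈𝒞 (λ y → shifted-<) (λ x y x<y _ → +-monoʳ-< c x<y)
            (λ y → val-β)


module Extension (k : ℕ) where

  open Values
  open Cuts
  open import Data.Nat as ℕ using (ℕ; suc; _≤_; _<_; _∸_; _≤?_)
  import Data.Nat.Properties as ℕP
  open import Data.Integer as ℤ using (ℤ; +_; _+_; _-_; _*_)
  import Data.Integer.Properties as ℤP
  open import Data.Integer.DivMod using (_/ℕ_; _%ℕ_; n%ℕd<d; a≡a%ℕn+[a/ℕn]*n)
  open import Data.Integer.Tactic.RingSolver using (solve-∀)
  open import Algebra.Bundles using (AbelianGroup)
  open import Algebra.Properties.Group (AbelianGroup.group ℤP.+-0-abelianGroup) using (∙-cancelʳ)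
  open import Data.Product using (Σ; _×_; _,_; proj₁)
  open import Data.Sum using (inj₁; inj₂)
  open import Relation.Nullary using (yes; no)
  open import Relation.Binary using (tri<; tri≈; tri>)
  open import Data.Empty using (⊥-elim)
  open import Relation.Binary.PropositionalEquality hiding ([_])

  N : ℕ
  N = suc k

  NZ : ℤ
  NZ = + N

  divMod : ∀ m → Σ ℕ λ x → Σ ℤ λ q → x < N × m ≡ + x + q * NZ
  divMod m = m %ℕ N , m /ℕ N , n%ℕd<d m N , a≡a%ℕn+[a/ℕn]*n m N

  lower-quotient-< : ∀ x y q p → x < N → q ℤ.< p → + x + q * NZ ℤ.< + y + p * NZ
  lower-quotient-< x y q p x<N q<p =
    ℤP.<-≤-trans (ℤP.+-monoˡ-< (q * NZ) (ℤ.+<+ x<N))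
      (ℤP.≤-trans (ℤP.≤-reflexive (suc-* q NZ))
        (ℤP.≤-trans (ℤP.*-monoʳ-≤-nonNeg NZ (ℤP.i<j⇒suc[i]≤j q<p)) (ℤP.i≤j+i (p * NZ) (+ y))))
    where
    suc-* : ∀ q n → n + q * n ≡ (+ 1 + q) * n
    suc-* = solve-∀

  divMod-unique : ∀ x y q p → x < N → y < N → + x + q * NZ ≡ + y + p * NZ → x ≡ y × q ≡ p
  divMod-unique x y q p x<N y<N e with ℤP.<-cmp q p
  ... | tri< q<p _ _ = ⊥-elim (ℤP.<-irrefl e (lower-quotient-< x y q p x<N q<p))
  ... | tri> _ _ p<q = ⊥-elim (ℤP.<-irrefl (sym e) (lower-quotient-< y x p q y<N p<q))
  ... | tri≈ _ refl _ = ℤP.+-injective (∙-cancelʳ (q * NZ) (+ x) (+ y) e) , refl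

  oplusZ-spec : (π : Perm N) → ∀ m x q → x < N → m - + 1 ≡ + x + q * NZ → oplusZ π m ≡ + suc (val π x) + q * NZ
  oplusZ-spec π m x q x<N e
    with divMod-unique x ((m - + 1) %ℕ N) q ((m - + 1) /ℕ N) x<N (n%ℕd<d (m - + 1) N)
                       (trans (sym e) (a≡a%ℕn+[a/ℕn]*n (m - + 1) N))
  ... | refl , refl = cong (λ z → + suc z + ((m - + 1) /ℕ N) * NZ) (sym (val-fromℕ< π (n%ℕd<d (m - + 1) N)))

  oplusZ-+period : (π : Perm N) → ∀ m t → oplusZ π (m + t * NZ) ≡ oplusZ π m + t * NZ
  oplusZ-+period π m t with divMod (m - + 1)
  ... | x , q , x<N , e = begin
    oplusZ π (m + t * NZ)                ≡⟨ oplusZ-spec π (m + t * NZ) x (q + t) x<N index ⟩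
    + suc (val π x) + (q + t) * NZ       ≡⟨ sym (collect (+ suc (val π x)) q t NZ) ⟩
    (+ suc (val π x) + q * NZ) + t * NZ  ≡⟨ cong (_+ t * NZ) (sym (oplusZ-spec π m x q x<N e)) ⟩
    oplusZ π m + t * NZ                  ∎
    where
    open ≡-Reasoning
    collect : ∀ a q t n → (a + q * n) + t * n ≡ a + (q + t) * n
    collect = solve-∀
    pred-+ : ∀ m t n → (m + t * n) - + 1 ≡ (m - + 1) + t * n
    pred-+ = solve-∀
    index : (m + t * NZ) - + 1 ≡ + x + (q + t) * NZ
    index = trans (pred-+ m t NZ) (trans (cong (_+ t * NZ) e) (collect (+ x) q t NZ))

  oplusZ-+N : (π : Perm N) → ∀ m → oplusZ π (m + NZ) ≡ oplusZ π m + NZ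
  oplusZ-+N π m = trans (cong (λ z → oplusZ π (m + z)) (sym (ℤP.*-identityˡ NZ)))
    (trans (oplusZ-+period π m (+ 1)) (cong (λ z → oplusZ π m + z) (ℤP.*-identityˡ NZ)))

  oplusZ-at : (π : Perm N) → ∀ x → x < N → oplusZ π (+ suc x) ≡ + suc (val π x)
  oplusZ-at π x x<N = trans (oplusZ-spec π (+ suc x) x (+ 0) x<N (pred-suc (+ x) NZ)) (ℤP.+-identityʳ _)
    where
    pred-suc : ∀ x n → (+ 1 + x) - + 1 ≡ x + + 0 * n
    pred-suc = solve-∀

  oplusZ-injective : (σ ρ : Perm N) → (∀ m → oplusZ σ m ≡ oplusZ ρ m) → σ ≡ ρ
  oplusZ-injective σ ρ h = val-ext σ ρ λ x x<N →
    ℕP.suc-injective (ℤP.+-injective (trans (sym (oplusZ-at σ x x<N)) (trans (h (+ suc x)) (oplusZ-at ρ x x<N))))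

  pred-+c : ∀ m c → (m + c) - + 1 ≡ (m - + 1) + c
  pred-+c = solve-∀

  oplusZ-rotate : (π : Perm N) (c : ℕ) (h : Cut π c) → ∀ m → oplusZ (rotate π c h) m + + c ≡ oplusZ π (m + + c)
  oplusZ-rotate π c h m with divMod (m - + 1)
  ... | x , q , x<N , e with split< (N ∸ c) (subst (x <_) (sym (ℕP.m∸n+n≡m (proj₁ h))) x<N)
  ... | inj₁ x<w = begin
    oplusZ ρ m + + c                       ≡⟨ cong (_+ + c) (oplusZ-spec ρ m x q x<N e) ⟩
    + suc (val ρ x) + q * NZ + + c         ≡⟨ move-c (+ val ρ x) (q * NZ) (+ c) ⟩
    + suc (c ℕ.+ val ρ x) + q * NZ         ≡⟨ cong (λ v → + suc v + q * NZ) (val-rotate-lo x<w) ⟩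
    + suc (val π (c ℕ.+ x)) + q * NZ       ≡⟨ sym (oplusZ-spec π (m + + c) (c ℕ.+ x) q c+x<N index) ⟩
    oplusZ π (m + + c)                     ∎
    where
    open ≡-Reasoning
    open Split π c h using (shifted-<; val-rotate-lo)
    ρ : Perm N
    ρ = rotate π c h
    move-c : ∀ v a c → (+ 1 + v + a) + c ≡ (+ 1 + (c + v)) + a
    move-c = solve-∀
    swap-c : ∀ x a c → (x + a) + c ≡ (c + x) + a
    swap-c = solve-∀
    c+x<N : c ℕ.+ x < N
    c+x<N = shifted-< x<w
    index : (m + + c) - + 1 ≡ + (c ℕ.+ x) + q * NZ
    index = trans (pred-+c m (+ c)) (trans (cong (_+ + c) e) (swap-c (+ x) (q * NZ) (+ c)))
  ... | inj₂ (y , y<c , refl) = begin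
    oplusZ ρ m + + c                                 ≡⟨ cong (_+ + c) (oplusZ-spec ρ m (w ℕ.+ y) q x<N e) ⟩
    + suc (val ρ (w ℕ.+ y)) + q * NZ + + c           ≡⟨ cong (λ v → + suc v + q * NZ + + c) (val-rotate-hi y<c) ⟩
    + suc (w ℕ.+ val π y) + q * NZ + + c             ≡⟨ cong (λ n → + suc (w ℕ.+ val π y) + q * n + + c) N≡w+c ⟩
    + suc (w ℕ.+ val π y) + q * (+ w + + c) + + c    ≡⟨ wrap-value (+ val π y) (+ w) (+ c) q ⟩
    + suc (val π y) + (q + + 1) * (+ w + + c)        ≡⟨ cong (λ n → + suc (val π y) + (q + + 1) * n) (sym N≡w+c) ⟩
    + suc (val π y) + (q + + 1) * NZ                 ≡⟨ sym (oplusZ-spec π (m + + c) y (q + + 1) (ℕP.<-≤-trans y<c c≤n) index) ⟩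
    oplusZ π (m + + c)                               ∎
    where
    open ≡-Reasoning
    open Split π c h using (c≤n; val-rotate-hi)
    ρ : Perm N
    ρ = rotate π c h
    w : ℕ
    w = N ∸ c
    N≡w+c : NZ ≡ + w + + c
    N≡w+c = cong +_ (sym (ℕP.m∸n+n≡m c≤n))
    wrap-value : ∀ u w c q → (+ 1 + (w + u) + q * (w + c)) + c ≡ (+ 1 + u) + (q + + 1) * (w + c)
    wrap-value = solve-∀
    wrap-index : ∀ y w c q → ((w + y) + q * (w + c)) + c ≡ y + (q + + 1) * (w + c)
    wrap-index = solve-∀
    index : (m + + c) - + 1 ≡ + y + (q + + 1) * NZ
    index = begin
      (m + + c) - + 1                           ≡⟨ pred-+c m (+ c) ⟩
      (m - + 1) + + c                           ≡⟨ cong (_+ + c) e ⟩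
      (+ (w ℕ.+ y) + q * NZ) + + c              ≡⟨ cong (λ n → (+ (w ℕ.+ y) + q * n) + + c) N≡w+c ⟩
      (+ (w ℕ.+ y) + q * (+ w + + c)) + + c     ≡⟨ wrap-index (+ y) (+ w) (+ c) q ⟩
      + y + (q + + 1) * (+ w + + c)             ≡⟨ cong (λ n → + y + (q + + 1) * n) (sym N≡w+c) ⟩
      + y + (q + + 1) * NZ                      ∎


  shiftExt : Perm N → ℤ → ℤ → ℤ
  shiftExt π r = shift r (oplusZ π)

  private
    regroup : ∀ a r b → a + (r + b) ≡ (a + b) + r
    regroup = solve-∀
    unshift : ∀ i r b → (i - (r + b)) + b ≡ i - r
    unshift = solve-∀

  shiftExt-period : (π : Perm N) → ∀ r t → shiftExt π (r + t * NZ) ≗ shiftExt π r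
  shiftExt-period π r t i = begin
    oplusZ π (i - (r + t * NZ)) + (r + t * NZ)      ≡⟨ regroup (oplusZ π (i - (r + t * NZ))) r (t * NZ) ⟩
    (oplusZ π (i - (r + t * NZ)) + t * NZ) + r      ≡⟨ cong (_+ r) (sym (oplusZ-+period π (i - (r + t * NZ)) t)) ⟩
    oplusZ π ((i - (r + t * NZ)) + t * NZ) + r      ≡⟨ cong (λ z → oplusZ π z + r) (unshift i r (t * NZ)) ⟩
    oplusZ π (i - r) + r                            ∎
    where open ≡-Reasoning

  shiftExt-rotate : (π : Perm N) (c : ℕ) (h : Cut π c) → ∀ r → shiftExt (rotate π c h) (r + + c) ≗ shiftExt π r
  shiftExt-rotate π c h r i = begin
    oplusZ (rotate π c h) (i - (r + + c)) + (r + + c)      ≡⟨ regroup (oplusZ (rotate π c h) (i - (r + + c))) r (+ c) ⟩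
    (oplusZ (rotate π c h) (i - (r + + c)) + + c) + r      ≡⟨ cong (_+ r) (oplusZ-rotate π c h (i - (r + + c))) ⟩
    oplusZ π ((i - (r + + c)) + + c) + r                   ≡⟨ cong (λ z → oplusZ π z + r) (unshift i r (+ c)) ⟩
    oplusZ π (i - r) + r                                   ∎
    where open ≡-Reasoning

  gap : ℕ → ℕ → ℕ
  gap r s with r ≤? s
  ... | yes _ = s ∸ r
  ... | no _ = s ℕ.+ N ∸ r

  gap-spec : ∀ r s → r < N → s < N → gap r s < N × Σ ℤ λ t → + r + + gap r s ≡ + s + t * NZ
  gap-spec r s r<N s<N with r ≤? s
  ... | yes r≤s = ℕP.≤-<-trans (ℕP.m∸n≤m s r) s<N
                , + 0 , trans (cong +_ (ℕP.m+[n∸m]≡n r≤s)) (sym (ℤP.+-identityʳ (+ s)))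
  ... | no r≰s = gap<N , + 1 , trans (cong +_ (ℕP.m+[n∸m]≡n r≤s+N)) (cong (λ z → + s + z) (sym (ℤP.*-identityˡ NZ)))
    where
    r≤s+N : r ≤ s ℕ.+ N
    r≤s+N = ℕP.≤-trans (ℕP.<⇒≤ r<N) (ℕP.m≤n+m N s)
    gap<N : s ℕ.+ N ∸ r < N
    gap<N = subst (s ℕ.+ N ∸ r <_) (ℕP.m+n∸m≡n r N) (ℕP.∸-monoˡ-< (ℕP.+-monoˡ-< N (ℕP.≰⇒> r≰s)) r≤s+N)

  gap-+ : ∀ r i → gap r (r ℕ.+ i) ≡ i
  gap-+ r i with r ≤? r ℕ.+ i
  ... | yes _ = ℕP.m+n∸m≡n r i
  ... | no r≰r+i = ⊥-elim (r≰r+i (ℕP.m≤m+n r i))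

  gap-< : ∀ r → r ≤ N → ∀ s → s < r → gap r s ≡ (N ∸ r) ℕ.+ s
  gap-< r r≤N s s<r with r ≤? s
  ... | yes r≤s = ⊥-elim (ℕP.<⇒≱ s<r r≤s)
  ... | no _ = trans (ℕP.+-∸-assoc s r≤N) (ℕP.+-comm s (N ∸ r))

  rotated⇒sameShift : ∀ π σ r s → r < N → s < N → RotatedAt π (gap r s) σ →
                      shiftExt σ (+ s) ≗ shiftExt π (+ r)
  rotated⇒sameShift π σ r s r<N s<N (h , refl) i with gap-spec r s r<N s<N
  ... | _ , t , r+d≡s+tN =
    trans (sym (shiftExt-period ρ (+ s) t i))
      (trans (cong (λ z → shiftExt ρ z i) (sym r+d≡s+tN)) (shiftExt-rotate π (gap r s) h (+ r) i))
    where
    ρ : Perm N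
    ρ = rotate π (gap r s) h

  sameShift⇒conjugate : ∀ π σ r s → r < N → s < N → shiftExt σ (+ s) ≗ shiftExt π (+ r) →
                        ∀ t → oplusZ σ t + + gap r s ≡ oplusZ π (t + + gap r s)
  sameShift⇒conjugate π σ r s r<N s<N same t with gap-spec r s r<N s<N
  ... | _ , tt , r+d≡s+T = begin
    oplusZ σ t + D                         ≡⟨ cong (λ z → oplusZ σ t + z) D≡ ⟩
    oplusZ σ t + ((S + T) - R)             ≡⟨ sym (reassoc (oplusZ σ t) S R T) ⟩
    ((oplusZ σ t + S) - R) + T             ≡⟨ cong (λ z → (z - R) + T) σ-side ⟩
    ((oplusZ π (t + S - R) + R) - R) + T   ≡⟨ cong (_+ T) (sym (add-sub (oplusZ π (t + S - R)) R)) ⟩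
    oplusZ π (t + S - R) + T               ≡⟨ sym (oplusZ-+period π (t + S - R) tt) ⟩
    oplusZ π ((t + S - R) + T)             ≡⟨ cong (oplusZ π) (reassoc t S R T) ⟩
    oplusZ π (t + ((S + T) - R))           ≡⟨ cong (λ z → oplusZ π (t + z)) (sym D≡) ⟩
    oplusZ π (t + D)                       ∎
    where
    open ≡-Reasoning
    D R S T : ℤ
    D = + gap r s
    R = + r
    S = + s
    T = tt * NZ
    add-sub : ∀ a b → a ≡ (a + b) - b
    add-sub = solve-∀
    reassoc : ∀ a s r t → ((a + s) - r) + t ≡ a + ((s + t) - r)
    reassoc = solve-∀
    sub-add : ∀ r d → d ≡ (r + d) - r
    sub-add = solve-∀
    D≡ : D ≡ (S + T) - R
    D≡ = trans (sub-add R D) (cong (_- R) r+d≡s+T)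
    σ-side : oplusZ σ t + S ≡ oplusZ π (t + S - R) + R
    σ-side = trans (cong (λ z → oplusZ σ z + S) (add-sub t S)) (same (t + S))

  conjugate⇒cut : ∀ π σ c → c < N → (∀ t → oplusZ σ t + + c ≡ oplusZ π (t + + c)) → Cut π c
  conjugate⇒cut π σ c c<N H = ℕP.<⇒≤ c<N , λ x x<N → inward x x<N , outward x x<N
    where
    H-at : ∀ j → j < N → + (suc (val σ j) ℕ.+ c) ≡ oplusZ π (+ suc (j ℕ.+ c))
    H-at j j<N = trans (cong (_+ + c) (sym (oplusZ-at σ j j<N))) (H (+ suc j))
    -- x < c: compare with j = x + N - c, so that π(x) + N = σ(j) + c < N + c
    inward : ∀ x → x < N → x < c → val π x < c
    inward x x<N x<c = ℕP.+-cancelʳ-< N (val π x) c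
      (subst (_< c ℕ.+ N) σj+c≡πx+N (subst (val σ j ℕ.+ c <_) (ℕP.+-comm N c) (ℕP.+-monoˡ-< c (val-< σ j<N))))
      where
      c≤x+N : c ≤ x ℕ.+ N
      c≤x+N = ℕP.≤-trans (ℕP.<⇒≤ c<N) (ℕP.m≤n+m N x)
      j : ℕ
      j = x ℕ.+ N ∸ c
      j<N : j < N
      j<N = subst (j <_) (ℕP.m+n∸m≡n c N) (ℕP.∸-monoˡ-< (ℕP.+-monoˡ-< N x<c) c≤x+N)
      σj+c≡πx+N : val σ j ℕ.+ c ≡ val π x ℕ.+ N
      σj+c≡πx+N = ℕP.suc-injective (ℤP.+-injective (trans (H-at j j<N)
        (trans (cong (λ z → oplusZ π (+ suc z)) (ℕP.m∸n+n≡m c≤x+N))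
          (trans (oplusZ-+N π (+ suc x)) (cong (_+ NZ) (oplusZ-at π x x<N))))))
    -- c ≤ x: with j = x - c we get π(x) = σ(j) + c ≥ c
    outward : ∀ x → x < N → val π x < c → x < c
    outward x x<N πx<c with x ℕ.<? c
    ... | yes x<c = x<c
    ... | no x≮c = ⊥-elim (ℕP.<⇒≱ πx<c (subst (c ≤_) σj+c≡πx (ℕP.m≤n+m c (val σ j))))
      where
      c≤x : c ≤ x
      c≤x = ℕP.≮⇒≥ x≮c
      j : ℕ
      j = x ∸ c
      j<N : j < N
      j<N = ℕP.≤-<-trans (ℕP.m∸n≤m x c) x<N
      σj+c≡πx : val σ j ℕ.+ c ≡ val π x
      σj+c≡πx = ℕP.suc-injective (ℤP.+-injective (trans (H-at j j<N)
        (trans (cong (λ z → oplusZ π (+ suc z)) (ℕP.m∸n+n≡m c≤x)) (oplusZ-at π x x<N))))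

  sameShift⇒rotated : ∀ π σ r s → r < N → s < N → shiftExt σ (+ s) ≗ shiftExt π (+ r) →
                      RotatedAt π (gap r s) σ
  sameShift⇒rotated π σ r s r<N s<N same = h , oplusZ-injective σ (rotate π d h) λ t →
      ∙-cancelʳ (+ d) _ _ (trans (conj t) (sym (oplusZ-rotate π d h t)))
    where
    d : ℕ
    d = gap r s
    conj : ∀ t → oplusZ σ t + + d ≡ oplusZ π (t + + d)
    conj = sameShift⇒conjugate π σ r s r<N s<N same
    h : Cut π d
    h = conjugate⇒cut π σ d (proj₁ (gap-spec r s r<N s<N)) conj


module Count (𝒞 : PermClass) (sum-closed : SumClosed 𝒞) (k : ℕ)
  (L : List (Perm (suc k))) (L-unique : Unique L) (L-spec : ∀ π → (π ∈ L) ⇔ C 𝒞 (suc k) π)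
  (χ : Perm (suc k) → ℕ) (χ-blocks : ∀ π → C 𝒞 (suc k) π → HasBlocks (suc k) π (χ π)) where

  open NatRat
  open Sums
  open Cuts
  open Closure 𝒞
  open Extension k
  open import Data.Nat as ℕ using (_≤_)
  import Data.Nat.Properties as ℕP
  open import Data.Fin as Fin using (Fin; toℕ; fromℕ<)
  open import Data.Fin.Properties using (toℕ<n; toℕ-fromℕ<)
  open import Data.Integer as ℤ using (ℤ; +_)
  open import Data.Rational as ℚ using (ℚ)
  open import Data.List using (_∷_; []; _++_; map; length; lookup; allFin)
  open import Data.List.Properties using (length-tabulate)
  open import Data.List.Membership.Propositional.Properties using (∈-map⁺; ∈-map⁻; ∈-++⁺ˡ; ∈-++⁺ʳ; ∈-++⁻; ∈-lookup; ∈-allFin)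
  open import Data.List.Relation.Unary.Any using (Any; here; there; index)
  open import Data.List.Relation.Unary.Any.Properties using (lookup-index)
  open import Data.Product using (Σ; ∃; _×_; _,_; proj₁; proj₂)
  open import Data.Sum using (inj₁; inj₂)
  open import Function using (_∘_)
  open import Function.Bundles using (Equivalence)
  open import Relation.Nullary.Decidable using (map′)
  open import Relation.Binary.PropositionalEquality

  Point : Set
  Point = Perm N × Fin N

  ext : Point → ℤ → ℤ
  ext (π , i) = shiftExt π (+ toℕ i)

  SameExt : Point → Point → Set
  SameExt x y = ext x ≗ ext y

  -- Same extension ⇔ rotation at the gap, which is decidable.
  sameExt? : ∀ x y → Dec (SameExt x y)
  sameExt? (π , i) (σ , j) =
    map′ (λ rot t → sym (rotated⇒sameShift π σ (toℕ i) (toℕ j) (toℕ<n i) (toℕ<n j) rot t))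
         (λ same → sameShift⇒rotated π σ (toℕ i) (toℕ j) (toℕ<n i) (toℕ<n j) (λ t → sym (same t)))
         (rotatedAt? (cut? π (gap (toℕ i) (toℕ j))) σ)

  module Classes = ClassCount SameExt sameExt? (λ x t → refl) (λ e t → sym (e t)) (λ e₁ e₂ t → trans (e₁ t) (e₂ t))
  open Classes

  pointsOver : List (Perm N) → List Point
  pointsOver [] = []
  pointsOver (π ∷ πs) = map (π ,_) (allFin N) ++ pointsOver πs

  pointsOver-∈ : ∀ πs {z} → z ∈ pointsOver πs → proj₁ z ∈ πs
  pointsOver-∈ (π ∷ πs) p with ∈-++⁻ (map (π ,_) (allFin N)) p
  ... | inj₁ q with ∈-map⁻ (π ,_) q
  ...   | _ , _ , refl = here refl
  pointsOver-∈ (π ∷ πs) p | inj₂ q = there (pointsOver-∈ πs q)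

  ∈-pointsOver : ∀ πs {π} → π ∈ πs → ∀ i → (π , i) ∈ pointsOver πs
  ∈-pointsOver (π ∷ πs) (here refl) i = ∈-++⁺ˡ (∈-map⁺ (π ,_) (∈-allFin i))
  ∈-pointsOver (σ ∷ πs) (there p) i = ∈-++⁺ʳ (map (σ ,_) (allFin N)) (∈-pointsOver πs p i)

  Σℕ-pointsOver : ∀ πs (G : Point → ℕ) → Σℕ (pointsOver πs) G ≡ Σℕ πs (λ σ → Σℕ (allFin N) (λ j → G (σ , j)))
  Σℕ-pointsOver [] G = refl
  Σℕ-pointsOver (π ∷ πs) G = trans (Σℕ-++ (map (π ,_) (allFin N)) (pointsOver πs) G)
    (cong₂ ℕ._+_ (Σℕ-map (allFin N) (π ,_) G) (Σℕ-pointsOver πs G))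

  Σℚ-pointsOver : ∀ πs (g : Perm N → ℚ) → Σℚ (pointsOver πs) (g ∘ proj₁) ≡ Σℚ πs (λ π → fromℕ N ℚ.* g π)
  Σℚ-pointsOver [] g = refl
  Σℚ-pointsOver (π ∷ πs) g = trans (Σℚ-++ (map (π ,_) (allFin N)) (pointsOver πs) (g ∘ proj₁))
    (cong₂ ℚ._+_ (trans (Σℚ-map (allFin N) (π ,_) (g ∘ proj₁))
                  (trans (Σℚ-const (allFin N) (g π)) (cong (λ t → fromℕ t ℚ.* g π) (length-tabulate {n = N} (λ i → i)))))
                 (Σℚ-pointsOver πs g))

  X : List Point
  X = pointsOver L

  X-∈𝒞 : ∀ {z} → z ∈ X → C 𝒞 N (proj₁ z)
  X-∈𝒞 {z} p = Equivalence.to (L-spec (proj₁ z)) (pointsOver-∈ L p)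

  -- The class of (π , i) in X has χ(π) elements: one for each cut d of π, namely
  -- (rotation of π at d , i + d mod N).
  classSize≡χ : ∀ π i → C 𝒞 N π → classSize (π , i) X ≡ χ π
  classSize≡χ π i π∈𝒞 = begin
    classSize (π , i) X
      ≡⟨ classSize-Σℕ (π , i) X ⟩
    Σℕ X (λ y → 𝟙 (sameExt? (π , i) y))
      ≡⟨ Σℕ-pointsOver L _ ⟩
    Σℕ L (λ σ → Σℕ (allFin N) (λ j → 𝟙 (sameExt? (π , i) (σ , j))))
      ≡⟨ Σℕ-cong L (λ σ _ → Σℕ-cong (allFin N) (λ j _ → 𝟙-map′ _ _ _)) ⟩
    Σℕ L (λ σ → Σℕ (allFin N) (λ j → 𝟙 (rotatedAt? (cut? π (d j)) σ)))
      ≡⟨ Σℕ-swap L (allFin N) _ ⟩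
    Σℕ (allFin N) (λ j → Σℕ L (λ σ → 𝟙 (rotatedAt? (cut? π (d j)) σ)))
      ≡⟨ Σℕ-cong (allFin N) (λ j _ → count-rotatedAt π (d j) L L-unique (rotation∈L (d j)) (cut? π (d j))) ⟩
    Σℕ (allFin N) (λ j → 𝟙 (cut? π (d j)))
      ≡⟨ Σℕ-allFin N (λ s → 𝟙 (cut? π (gap r s))) ⟩
    sumBelow N (λ s → 𝟙 (cut? π (gap r s)))
      ≡⟨ sumBelow-rotate N r (gap r) (λ c → 𝟙 (cut? π c)) r≤N (gap-+ r) (gap-< r r≤N) ⟩
    cutCount π
      ≡⟨ blocks≡cutCount (χ-blocks π π∈𝒞) ⟩
    χ π
      ∎
    where
    open ≡-Reasoning
    r : ℕ
    r = toℕ i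
    r≤N : r ≤ N
    r≤N = ℕP.<⇒≤ (toℕ<n i)
    d : Fin N → ℕ
    d j = gap r (toℕ j)
    rotation∈L : ∀ c (h : Cut π c) → rotate π c h ∈ L
    rotation∈L c h = Equivalence.from (L-spec _) (rotate-∈ sum-closed h π∈𝒞)

  R : List Point
  R = representatives X

  enumerate : Fin (length R) → Perm N × ℤ
  enumerate q = proj₁ (lookup R q) , + toℕ (proj₂ (lookup R q))

  enumerate-onto : ∀ (a : Perm N × ℤ) → C 𝒞 N (proj₁ a) →
    ∃ λ q → shift (proj₂ (enumerate q)) (oplusZ (proj₁ (enumerate q))) ≗ shift (proj₂ a) (oplusZ (proj₁ a))
  enumerate-onto (π , r) π∈𝒞 with divMod r
  ... | x , t , x<N , r≡x+tN = index covered , λ i → begin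
    ext (lookup R (index covered)) i      ≡⟨ lookup-index covered i ⟩
    shiftExt π (+ toℕ (fromℕ< x<N)) i     ≡⟨ cong (λ z → shiftExt π (+ z) i) (toℕ-fromℕ< x<N) ⟩
    shiftExt π (+ x) i                    ≡⟨ sym (shiftExt-period π (+ x) t i) ⟩
    shiftExt π (+ x ℤ.+ t ℤ.* NZ) i       ≡⟨ cong (λ z → shiftExt π z i) (sym r≡x+tN) ⟩
    shiftExt π r i                        ∎
    where
    open ≡-Reasoning
    covered : Any (λ w → SameExt w (π , fromℕ< x<N)) R
    covered = representatives-cover X (∈-pointsOver L (Equivalence.from (L-spec π) π∈𝒞) (fromℕ< x<N))

  imageCard : ImageCard (λ (p : Perm N × ℤ) → C 𝒞 N (proj₁ p)) (λ p → shift (proj₂ p) (oplusZ (proj₁ p))) _≗_ (length R)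
  imageCard = enumerate
            , (λ q → X-∈𝒞 (representatives-⊆ X (∈-lookup q)))
            , representatives-injective X
            , enumerate-onto

  -- Each π contributes N points of weight 1/χ(π).
  weight-X : weight X ≡ fromℕ N ℚ.* sumℚ (map (recip ∘ χ) L)
  weight-X = begin
    weight X                                      ≡⟨ Σℚ-cong X (λ z p → cong recip (classSize≡χ (proj₁ z) (proj₂ z) (X-∈𝒞 p))) ⟩
    Σℚ X (recip ∘ χ ∘ proj₁)                      ≡⟨ Σℚ-pointsOver L (recip ∘ χ) ⟩
    Σℚ L (λ π → fromℕ N ℚ.* recip (χ π))          ≡⟨ Σℚ-*ˡ L (fromℕ N) (recip ∘ χ) ⟩
    fromℕ N ℚ.* sumℚ (map (recip ∘ χ) L)          ∎
    where open ≡-Reasoning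


open NatRat using (fromℕ)
open import Data.Nat using (_≤_; s≤s; z≤n)
open import Data.Integer using (ℤ; +_)
open import Data.Rational using (_/_; _*_)
open import Data.List using (map; length)
open import Data.Product using (Σ; _×_; _,_; proj₁; proj₂)
open import Function using (_∘_)
open import Relation.Binary.PropositionalEquality using (_≡_; _≗_; sym; module ≡-Reasoning)

lemma4p1 : (𝒞 : PermClass) → SumClosed 𝒞 →
    (n : ℕ) → 1 ≤ n →
    (L : List (Perm n)) → Unique L → (∀ π → (π ∈ L) ⇔ C 𝒞 n π) →
    (χ : Perm n → ℕ) → (∀ π → C 𝒞 n π → HasBlocks n π (χ π)) →
    Σ ℕ λ N →
      ImageCard (λ (p : Perm n × ℤ) → C 𝒞 n (proj₁ p))
                (λ p → shift (proj₂ p) (oplusZ (proj₁ p))) _≗_ N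
      × ((+ N / 1) ≡ (+ n / 1) * sumℚ (map (recip ∘ χ) L))
lemma4p1 𝒞 sum-closed (suc k) (s≤s z≤n) L L-unique L-spec χ χ-blocks =
  length R , imageCard , (begin
    fromℕ (length R)                                 ≡⟨ sym (weight≡#representatives X) ⟩
    weight X                                         ≡⟨ weight-X ⟩
    fromℕ (suc k) * sumℚ (map (recip ∘ χ) L)         ∎)
  where
  open Count 𝒞 sum-closed k L L-unique L-spec χ χ-blocks
  open Classes using (weight; weight≡#representatives)
  open ≡-Reasoning
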